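{- Let $\ell,m,n\ge 1$. The order of rowmotion $\mathrm{row}$ as a permutation of $J([\ell]\times[m]\times[n])$ is divisible by $m+n+\ell-1$.
   Context: $[a]$ is the $a$-element chain, $[\ell]\times[m]\times[n]$ the product poset with componentwise order, and $J(P)$ the set of order ideals of $P$. Rowmotion: $\mathrm{row}(I)$ is the order ideal generated by the minimal elements of $P\setminus I$. -}

module Defs where

open import Data.Nat using (ℕ; zero; suc; _+_; _∸_; _≤_; _<_)
open import Data.Nat.Divisibility using (_∣_)
open import Data.Fin using (Fin)
import Data.Fin as F
open import Data.Bool using (Bool; true; false; _∧_; _∨_; not; if_then_else_)
open import Data.List using (List; allFin; cartesianProduct)
open import Data.Bool.ListAction using (any; all)
open import Data.Product using (_×_; _,_; Σ)
open import Relation.Nullary.Decidable using (⌊_⌋)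
open import Relation.Binary.PropositionalEquality using (_≡_)
open import Function using (_∘_)

-- The product poset [ℓ] × [m] × [n]; [a] is modelled by Fin a
-- (elements 0,…,a-1 with the usual order).
Elt : ℕ → ℕ → ℕ → Set
Elt ℓ m n = Fin ℓ × Fin m × Fin n

_≤P_ : ∀ {ℓ m n} → Elt ℓ m n → Elt ℓ m n → Set
(a , b , c) ≤P (a' , b' , c') = (a F.≤ a') × (b F.≤ b') × (c F.≤ c')

leqb : ∀ {ℓ m n} → Elt ℓ m n → Elt ℓ m n → Bool
leqb (a , b , c) (a' , b' , c') = ⌊ a F.≤? a' ⌋ ∧ ⌊ b F.≤? b' ⌋ ∧ ⌊ c F.≤? c' ⌋

ltb : ∀ {ℓ m n} → Elt ℓ m n → Elt ℓ m n → Bool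
ltb z y = leqb z y ∧ not (leqb y z)

elems : ∀ ℓ m n → List (Elt ℓ m n)
elems ℓ m n = cartesianProduct (allFin ℓ) (cartesianProduct (allFin m) (allFin n))

Subset : ℕ → ℕ → ℕ → Set
Subset ℓ m n = Elt ℓ m n → Bool

IsOrderIdeal : ∀ {ℓ m n} → Subset ℓ m n → Set
IsOrderIdeal {ℓ} {m} {n} I =
  (x y : Elt ℓ m n) → y ≤P x → I x ≡ true → I y ≡ true

minimalOfComplement : ∀ {ℓ m n} → Subset ℓ m n → Elt ℓ m n → Bool
minimalOfComplement {ℓ} {m} {n} I y =
  not (I y) ∧ all (λ z → not (ltb z y) ∨ I z) (elems ℓ m n)

row : ∀ {ℓ m n} → Subset ℓ m n → Subset ℓ m n
row {ℓ} {m} {n} I x =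
  any (λ y → minimalOfComplement I y ∧ leqb x y) (elems ℓ m n)

rowIter : ∀ {ℓ m n} → ℕ → Subset ℓ m n → Subset ℓ m n
rowIter zero    I = I
rowIter (suc k) I = row (rowIter k I)

FixesAllIdeals : ℕ → ℕ → ℕ → ℕ → Set
FixesAllIdeals ℓ m n k =
  (I : Subset ℓ m n) → IsOrderIdeal I → (x : Elt ℓ m n) → rowIter k I x ≡ I x

IsOrderOfRow : ℕ → ℕ → ℕ → ℕ → Set
IsOrderOfRow ℓ m n k =
  (0 < k) × FixesAllIdeals ℓ m n k ×
  ((j : ℕ) → 0 < j → FixesAllIdeals ℓ m n j → k ≤ j)

-- Rowmotion is injective on order ideals: the minimal elements of P ∖ I form an antichain and
-- are the maximal elements of row I, so row I determines I.  Since J(P) is finite (codes in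
-- Fin 2^|P|), every orbit has length at most 2^|P|, row^(2^|P|)! is the identity, and the order
-- of rowmotion, the least positive such exponent, exists and is divisible by every orbit length.
-- With rank (a , b , c) = a + b + c ∈ [0, T], T = ℓ + m + n − 3, the rank ideals
-- L r = {x | rank x < r} satisfy row (L r) = L (r + 1) for r ≤ T and row (L (T + 1)) = L 0,
-- because the minimal elements outside L r are exactly the elements of rank r.  So L 0, …, L (T + 1)
-- is an orbit of length T + 2 = ℓ + m + n − 1.
module Submission where

open import Defs
open import Data.Nat using (ℕ; _+_; _∸_; _≤_)
open import Data.Nat.Divisibility using (_∣_)
open import Data.Product using (_×_; Σ)

open import Data.Nat.Base using (zero; suc; _*_; _^_; _<_; _!; z≤n; z<s; s≤s; s≤s⁻¹; NonZero; >-nonZero⁻¹)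
open import Data.Nat.Properties
open import Data.Nat.Divisibility using (divides; m∣m*n; ∣-trans; m≤n⇒m!∣n!; m%n≡0⇒n∣m)
open import Data.Nat.DivMod using (_%_; _/_; m≡m%n+[m/n]*n; m%n<n)
open import Data.Nat.Induction using (<-wellFounded)
import Data.Nat.Solver as ℕ-Solver
open import Data.Fin.Base as Fin using (Fin; toℕ; fromℕ<; funToFin; finToFun)
open import Data.Fin.Properties
  using (all?; pigeonhole; toℕ-fromℕ; toℕ-fromℕ<; toℕ<n; toℕ≤pred[n]; 2↔Bool; *↔×; finToFun-funToFin)
  renaming (_≤?_ to _≤ᶠ?_)
open import Data.Bool.Base using (Bool; true; false; not; _∧_; _∨_)
open import Data.Bool.Properties using (T-≡) renaming (_≟_ to _≟ᵇ_)
open import Data.Bool.ListAction using (any; all; and; or)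
open import Data.List.Base using (_∷_)
open import Data.List.Properties using (map-cong)
open import Data.List.Membership.Propositional using (_∈_)
open import Data.List.Membership.Propositional.Properties using (∈-cartesianProduct⁺; ∈-allFin)
open import Data.List.Relation.Unary.Any using (satisfied)
import Data.List.Relation.Unary.Any as Any
import Data.List.Relation.Unary.All as All
open import Data.List.Relation.Unary.Any.Properties using (any⁺; any⁻)
open import Data.List.Relation.Unary.All.Properties using (all⁺; all⁻)
open import Data.Product using (_,_; proj₁; proj₂; ∃; ∃-syntax)
import Data.Product as Product
open import Data.Product.Function.NonDependent.Propositional using (_×-↔_)
open import Data.Sum using (_⊎_; inj₁; inj₂)
open import Data.Empty using (⊥; ⊥-elim)
open import Function using (_∘_; _↔_; Inverse; Equivalence)
open import Function.Properties.Inverse using (↔-refl; ↔-trans)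
open import Induction.WellFounded using (WellFounded; Acc; acc)
import Relation.Binary.Construct.On as On
open import Relation.Nullary using (Dec; yes; no; ¬_; contradiction)
open import Relation.Nullary.Decidable using (does; map′; _×-dec_; _→-dec_; dec-true; dec-false; isYes≗does)
open import Relation.Unary using (Decidable)
open import Relation.Binary.PropositionalEquality

Bool-ext : ∀ {a b : Bool} → (a ≡ true → b ≡ true) → (b ≡ true → a ≡ true) → a ≡ b
Bool-ext {true}  {true}  _ _ = refl
Bool-ext {true}  {false} f _ = sym (f refl)
Bool-ext {false} {true}  _ g = g refl
Bool-ext {false} {false} _ _ = refl

¬false⇒true : ∀ {a : Bool} → ¬ a ≡ false → a ≡ true
¬false⇒true {true}  _ = refl
¬false⇒true {false} h = contradiction refl h

true≢false : ∀ {a : Bool} → a ≡ true → a ≡ false → ⊥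
true≢false refl ()

∧-true⁻ : ∀ {a b} → a ∧ b ≡ true → a ≡ true × b ≡ true
∧-true⁻ {true} {true} _ = refl , refl

not-true⁻ : ∀ {a} → not a ≡ true → a ≡ false
not-true⁻ {false} _ = refl

not-∧-false⁻ : ∀ {a b} → a ≡ false → not a ∧ b ≡ false → b ≡ false
not-∧-false⁻ refl h = h

not-∨-true⁺ : ∀ {a b} → (a ≡ true → b ≡ true) → not a ∨ b ≡ true
not-∨-true⁺ {true}  f = f refl
not-∨-true⁺ {false} _ = refl

not-∨-true⁻ : ∀ {a b} → not a ∨ b ≡ true → a ≡ true → b ≡ true
not-∨-true⁻ {true} h refl = h

not-∨-false⁻ : ∀ {a b} → not a ∨ b ≡ false → a ≡ true × b ≡ false
not-∨-false⁻ {true} {false} _ = refl , refl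

does-true⁻ : ∀ {A : Set} (a? : Dec A) → does a? ≡ true → A
does-true⁻ (yes a) _ = a

module _ {A : Set} (p : A → Bool) where

  any-true⁻ : ∀ xs → any p xs ≡ true → ∃[ x ] p x ≡ true
  any-true⁻ xs = Product.map₂ (Equivalence.to T-≡) ∘ satisfied ∘ any⁻ p xs ∘ Equivalence.from T-≡

  any-true⁺ : ∀ {x xs} → x ∈ xs → p x ≡ true → any p xs ≡ true
  any-true⁺ x∈xs px = Equivalence.to T-≡ (any⁺ p (Any.map (λ { refl → Equivalence.from T-≡ px }) x∈xs))

  all-true⁻ : ∀ xs → all p xs ≡ true → ∀ {x} → x ∈ xs → p x ≡ true
  all-true⁻ xs h = Equivalence.to T-≡ ∘ All.lookup (all⁺ p xs (Equivalence.from T-≡ h))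

  all-true⁺ : ∀ xs → (∀ x → p x ≡ true) → all p xs ≡ true
  all-true⁺ xs h = Equivalence.to T-≡ (all⁻ p {xs} (All.tabulate (λ {x} _ → Equivalence.from T-≡ (h x))))

  all-false⁻ : ∀ xs → all p xs ≡ false → ∃[ x ] p x ≡ false
  all-false⁻ (x ∷ xs) h with p x in eq
  ... | false = x , eq
  ... | true  = all-false⁻ xs h

IsLeastPositive : (ℕ → Set) → ℕ → Set
IsLeastPositive P k = 0 < k × P k × (∀ j → 0 < j → P j → k ≤ j)

module _ {P : ℕ → Set} (P? : Decidable P) where

  leastPositive-search : ∀ K → ∃ (IsLeastPositive P) ⊎ (∀ j → 0 < j → j ≤ K → ¬ P j)
  leastPositive-search zero = inj₂ λ j 0<j j≤0 _ → <⇒≱ 0<j j≤0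
  leastPositive-search (suc K) with leastPositive-search K | P? (suc K)
  ... | inj₁ least | _       = inj₁ least
  ... | inj₂ none  | yes PsK =
    inj₁ (suc K , s≤s z≤n , PsK , λ j 0<j Pj → ≮⇒≥ λ j<sK → none j 0<j (s≤s⁻¹ j<sK) Pj)
  ... | inj₂ none  | no ¬PsK = inj₂ below
    where
    below : ∀ j → 0 < j → j ≤ suc K → ¬ P j
    below j 0<j j≤sK with m≤n⇒m<n∨m≡n j≤sK
    ... | inj₁ j<sK = none j 0<j (s≤s⁻¹ j<sK)
    ... | inj₂ refl = ¬PsK

  leastPositive : ∀ K → 0 < K → P K → ∃ (IsLeastPositive P)
  leastPositive K 0<K PK with leastPositive-search K
  ... | inj₁ least = least
  ... | inj₂ none  = contradiction PK (none K 0<K ≤-refl)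

0<m≤n⇒m∣n! : ∀ {m n} → 0 < m → m ≤ n → m ∣ n !
0<m≤n⇒m∣n! {suc m} _ m≤n = ∣-trans (m∣m*n (m !)) (m≤n⇒m!∣n! m≤n)

module SubsetCode {A : Set} {N : ℕ} (Fin↔A : Fin N ↔ A) where

  encode : (A → Bool) → Fin (2 ^ N)
  encode I = funToFin (Inverse.from 2↔Bool ∘ I ∘ Inverse.to Fin↔A)

  decode : Fin (2 ^ N) → A → Bool
  decode c = Inverse.to 2↔Bool ∘ finToFun c ∘ Inverse.from Fin↔A

  decode-encode : ∀ I → decode (encode I) ≗ I
  decode-encode I x = begin
    Inverse.to 2↔Bool (finToFun (encode I) (Inverse.from Fin↔A x))
      ≡⟨ cong (Inverse.to 2↔Bool) (finToFun-funToFin _ (Inverse.from Fin↔A x)) ⟩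
    Inverse.to 2↔Bool (Inverse.from 2↔Bool (I (Inverse.to Fin↔A (Inverse.from Fin↔A x))))
      ≡⟨ Inverse.strictlyInverseˡ 2↔Bool _ ⟩
    I (Inverse.to Fin↔A (Inverse.from Fin↔A x))
      ≡⟨ cong I (Inverse.strictlyInverseˡ Fin↔A x) ⟩
    I x ∎
    where open ≡-Reasoning

  encode-injective : ∀ {I J} → encode I ≡ encode J → I ≗ J
  encode-injective {I} {J} eq x =
    trans (sym (decode-encode I x)) (trans (cong (λ c → decode c x) eq) (decode-encode J x))

module Rowmotion (ℓ m n : ℕ) where

  E : Set
  E = Elt ℓ m n

  ∈-elems : (x : E) → x ∈ elems ℓ m n
  ∈-elems (a , b , c) = ∈-cartesianProduct⁺ (∈-allFin a) (∈-cartesianProduct⁺ (∈-allFin b) (∈-allFin c))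

  _≤P?_ : (x y : E) → Dec (x ≤P y)
  (a , b , c) ≤P? (a′ , b′ , c′) = a ≤ᶠ? a′ ×-dec b ≤ᶠ? b′ ×-dec c ≤ᶠ? c′

  -- Defs tests with ⌊_⌋ = isYes, which agrees with does only propositionally.
  leqb≡does-≤P? : ∀ x y → leqb x y ≡ does (x ≤P? y)
  leqb≡does-≤P? (a , b , c) (a′ , b′ , c′) =
    cong₂ _∧_ (isYes≗does (a ≤ᶠ? a′)) (cong₂ _∧_ (isYes≗does (b ≤ᶠ? b′)) (isYes≗does (c ≤ᶠ? c′)))

  leqb⇒≤P : ∀ {x y} → leqb x y ≡ true → x ≤P y
  leqb⇒≤P {x} {y} h = does-true⁻ (x ≤P? y) (trans (sym (leqb≡does-≤P? x y)) h)

  ≤P⇒leqb : ∀ {x y} → x ≤P y → leqb x y ≡ true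
  ≤P⇒leqb {x} {y} x≤y = trans (leqb≡does-≤P? x y) (dec-true (x ≤P? y) x≤y)

  ≤P-refl : ∀ {x : E} → x ≤P x
  ≤P-refl = ≤-refl , ≤-refl , ≤-refl

  ≤P-trans : ∀ {x y z : E} → x ≤P y → y ≤P z → x ≤P z
  ≤P-trans (p , q , r) (p′ , q′ , r′) = ≤-trans p p′ , ≤-trans q q′ , ≤-trans r r′

  ≰P⇒leqb : ∀ {x y} → ¬ x ≤P y → leqb x y ≡ false
  ≰P⇒leqb {x} {y} x≰y = trans (leqb≡does-≤P? x y) (dec-false (x ≤P? y) x≰y)

  ltb⇒<P : ∀ {z y} → ltb z y ≡ true → z ≤P y × ¬ y ≤P z
  ltb⇒<P h = let z≤y , y≰z = ∧-true⁻ h in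
    leqb⇒≤P z≤y , λ y≤z → true≢false (≤P⇒leqb y≤z) (not-true⁻ y≰z)

  <P⇒ltb : ∀ {z y} → z ≤P y → ¬ y ≤P z → ltb z y ≡ true
  <P⇒ltb z≤y y≰z = cong₂ _∧_ (≤P⇒leqb z≤y) (cong not (≰P⇒leqb y≰z))

  rank : E → ℕ
  rank (a , b , c) = toℕ a + toℕ b + toℕ c

  rank-mono : ∀ {x y} → x ≤P y → rank x ≤ rank y
  rank-mono (p , q , r) = +-mono-≤ (+-mono-≤ p q) r

  <P⇒rank< : ∀ {z y} → z ≤P y → ¬ y ≤P z → rank z < rank y
  <P⇒rank< {a , b , c} {a′ , b′ , c′} (p , q , r) y≰z
    with toℕ a′ ≤? toℕ a | toℕ b′ ≤? toℕ b | toℕ c′ ≤? toℕ c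
  ... | yes p′ | yes q′ | yes r′ = contradiction (p′ , q′ , r′) y≰z
  ... | no p′  | _      | _      = +-mono-<-≤ (+-mono-<-≤ (≰⇒> p′) q) r
  ... | yes _  | no q′  | _      = +-mono-<-≤ (+-mono-≤-< p (≰⇒> q′)) r
  ... | yes _  | yes _  | no r′  = +-mono-≤-< (+-mono-≤ p q) (≰⇒> r′)

  ltb⇒rank< : ∀ {z y} → ltb z y ≡ true → rank z < rank y
  ltb⇒rank< {z} {y} = Product.uncurry (<P⇒rank< {z} {y}) ∘ ltb⇒<P

  rank<⇒ltb : ∀ {z y} → z ≤P y → rank z < rank y → ltb z y ≡ true
  rank<⇒ltb z≤y rz<ry = <P⇒ltb z≤y λ y≤z → <⇒≱ rz<ry (rank-mono y≤z)

  cover-step : ∀ {k} (i j : Fin k) → toℕ i < toℕ j →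
               ∃[ h ] i Fin.≤ h × h Fin.≤ j × toℕ h ≡ suc (toℕ i)
  cover-step i j i<j =
    fromℕ< (≤-<-trans i<j (toℕ<n j)) ,
    ≤-trans (n≤1+n (toℕ i)) (≤-reflexive (sym h≡)) , ≤-trans (≤-reflexive h≡) i<j , h≡
    where
    h≡ = toℕ-fromℕ< (≤-<-trans i<j (toℕ<n j))

  cover-up : ∀ {x y} → x ≤P y → rank x < rank y →
             ∃[ x′ ] x ≤P x′ × x′ ≤P y × rank x′ ≡ suc (rank x)
  cover-up {a , b , c} {a′ , b′ , c′} (p , q , r) rx<ry
    with toℕ a <? toℕ a′ | toℕ b <? toℕ b′ | toℕ c <? toℕ c′
  ... | yes a<a′ | _ | _ = let h , a≤h , h≤a′ , h≡ = cover-step a a′ a<a′ in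
    (h , b , c) , (a≤h , ≤-refl , ≤-refl) , (h≤a′ , q , r) , cong (λ t → t + toℕ b + toℕ c) h≡
  ... | no _ | yes b<b′ | _ = let h , b≤h , h≤b′ , h≡ = cover-step b b′ b<b′ in
    (a , h , c) , (≤-refl , b≤h , ≤-refl) , (p , h≤b′ , r) ,
    trans (cong (λ t → toℕ a + t + toℕ c) h≡) (cong (_+ toℕ c) (+-suc (toℕ a) (toℕ b)))
  ... | no _ | no _ | yes c<c′ = let h , c≤h , h≤c′ , h≡ = cover-step c c′ c<c′ in
    (a , b , h) , (≤-refl , ≤-refl , c≤h) , (p , q , h≤c′) ,
    trans (cong (toℕ a + toℕ b +_) h≡) (+-suc (toℕ a + toℕ b) (toℕ c))
  ... | no a≮a′ | no b≮b′ | no c≮c′ =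
    contradiction rx<ry (≤⇒≯ (+-mono-≤ (+-mono-≤ (≮⇒≥ a≮a′) (≮⇒≥ b≮b′)) (≮⇒≥ c≮c′)))

  between-+ : ∀ d {x y} → x ≤P y → rank x + d ≤ rank y → ∃[ z ] x ≤P z × z ≤P y × rank z ≡ rank x + d
  between-+ zero {x} x≤y _ = x , ≤P-refl , x≤y , sym (+-identityʳ (rank x))
  between-+ (suc d) {x} {y} x≤y bound =
    let x′ , x≤x′ , x′≤y , rx′ = cover-up {x} {y} x≤y (<-≤-trans (m<m+n (rank x) z<s) bound)
        rx′+d = trans (cong (_+ d) rx′) (sym (+-suc (rank x) d))
        z , x′≤z , z≤y , rz = between-+ d {x′} {y} x′≤y (subst (_≤ rank y) (sym rx′+d) bound)
    in z , ≤P-trans {x} {x′} {z} x≤x′ x′≤z , z≤y , trans rz rx′+d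

  between : ∀ {x y r} → x ≤P y → rank x ≤ r → r ≤ rank y → ∃[ z ] x ≤P z × z ≤P y × rank z ≡ r
  between {x} {y} {r} x≤y rx≤r r≤ry =
    let bound = subst (_≤ rank y) (sym (m+[n∸m]≡n rx≤r)) r≤ry
        z , x≤z , z≤y , rz = between-+ (r ∸ rank x) {x} {y} x≤y bound
    in z , x≤z , z≤y , trans rz (m+[n∸m]≡n rx≤r)

  module _ (I : Subset ℓ m n) where

    minimal⁻ : ∀ {y} → minimalOfComplement I y ≡ true →
               I y ≡ false × (∀ z → ltb z y ≡ true → I z ≡ true)
    minimal⁻ h = let y∉I , below = ∧-true⁻ h in
      not-true⁻ y∉I , λ z → not-∨-true⁻ (all-true⁻ _ (elems ℓ m n) below (∈-elems z))

    minimal⁺ : ∀ {y} → I y ≡ false → (∀ z → ltb z y ≡ true → I z ≡ true) →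
               minimalOfComplement I y ≡ true
    minimal⁺ y∉I below =
      cong₂ _∧_ (cong not y∉I) (all-true⁺ _ (elems ℓ m n) λ z → not-∨-true⁺ (below z))

    minimal-antichain : ∀ {y y′} → minimalOfComplement I y ≡ true → minimalOfComplement I y′ ≡ true →
                        y ≤P y′ → y′ ≤P y
    minimal-antichain {y} {y′} my my′ y≤y′ with y′ ≤P? y
    ... | yes y′≤y = y′≤y
    ... | no  y′≰y =
      ⊥-elim (true≢false (proj₂ (minimal⁻ my′) y (<P⇒ltb y≤y′ y′≰y)) (proj₁ (minimal⁻ my)))

    non-minimal⇒smaller-outside : ∀ {y} → I y ≡ false → minimalOfComplement I y ≡ false →
                                  ∃[ z ] ltb z y ≡ true × I z ≡ false
    non-minimal⇒smaller-outside y∉I h =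
      let z , h′ = all-false⁻ _ (elems ℓ m n) (not-∧-false⁻ y∉I h) in z , not-∨-false⁻ h′

    minimal-below : ∀ {x} → I x ≡ false → ∃[ y ] minimalOfComplement I y ≡ true × y ≤P x
    minimal-below {x} = go (⊏-wellFounded x)
      where
      _⊏_ : E → E → Set
      z ⊏ y = rank z < rank y
      ⊏-wellFounded : WellFounded _⊏_
      ⊏-wellFounded = On.wellFounded rank <-wellFounded
      go : ∀ {x} → Acc _⊏_ x → I x ≡ false → ∃[ y ] minimalOfComplement I y ≡ true × y ≤P x
      go {x} (acc smaller) x∉I with minimalOfComplement I x in eq
      ... | true  = x , eq , ≤P-refl
      ... | false =
        let z , z<x , z∉I = non-minimal⇒smaller-outside {x} x∉I eq
            y , my , y≤z = go (smaller (ltb⇒rank< {z} {x} z<x)) z∉I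
        in y , my , ≤P-trans {y} {z} {x} y≤z (proj₁ (ltb⇒<P {z} {x} z<x))

    row⁻ : ∀ {x} → row I x ≡ true → ∃[ y ] minimalOfComplement I y ≡ true × x ≤P y
    row⁻ h =
      let y , h′ = any-true⁻ _ (elems ℓ m n) h
          my , x≤y = ∧-true⁻ h′
      in y , my , leqb⇒≤P x≤y

    row⁺ : ∀ {x y} → minimalOfComplement I y ≡ true → x ≤P y → row I x ≡ true
    row⁺ {y = y} my x≤y = any-true⁺ _ (∈-elems y) (cong₂ _∧_ my (≤P⇒leqb x≤y))

    row-isOrderIdeal : IsOrderIdeal (row I)
    row-isOrderIdeal x y y≤x h =
      let w , mw , x≤w = row⁻ {x} h in row⁺ {y} {w} mw (≤P-trans {y} {x} {w} y≤x x≤w)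

  minimal-cong : ∀ {I J : Subset ℓ m n} → I ≗ J → ∀ y → minimalOfComplement I y ≡ minimalOfComplement J y
  minimal-cong I≗J y =
    cong₂ _∧_ (cong not (I≗J y)) (cong and (map-cong (λ z → cong (not (ltb z y) ∨_) (I≗J z)) (elems ℓ m n)))

  row-cong : ∀ {I J : Subset ℓ m n} → I ≗ J → row I ≗ row J
  row-cong I≗J x = cong or (map-cong (λ y → cong (_∧ leqb x y) (minimal-cong I≗J y)) (elems ℓ m n))

  row-≗⇒⊆ : ∀ {I J : Subset ℓ m n} → IsOrderIdeal I → row I ≗ row J → ∀ x → I x ≡ true → J x ≡ true
  row-≗⇒⊆ {I} {J} I-ideal rowI≗rowJ x x∈I = ¬false⇒true λ x∉J →
    let y  , my  , y≤x   = minimal-below J x∉J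
        y′ , my′ , y≤y′  = row⁻ I {y} (trans (rowI≗rowJ y) (row⁺ J {y} {y} my ≤P-refl))
        y″ , my″ , y′≤y″ = row⁻ J {y′} (trans (sym (rowI≗rowJ y′)) (row⁺ I {y′} {y′} my′ ≤P-refl))
        y″≤y = minimal-antichain J my my″ (≤P-trans {y} {y′} {y″} y≤y′ y′≤y″)
        y′≤x = ≤P-trans {y′} {y″} {x} y′≤y″ (≤P-trans {y″} {y} {x} y″≤y y≤x)
    in true≢false (I-ideal x y′ y′≤x x∈I) (proj₁ (minimal⁻ I my′))

  row-injective : ∀ {I J : Subset ℓ m n} → IsOrderIdeal I → IsOrderIdeal J → row I ≗ row J → I ≗ J
  row-injective {I} {J} I-ideal J-ideal rowI≗rowJ x =
    Bool-ext (row-≗⇒⊆ {I} {J} I-ideal rowI≗rowJ x) (row-≗⇒⊆ {J} {I} J-ideal (sym ∘ rowI≗rowJ) x)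

  isOrderIdeal-cong : ∀ {I J : Subset ℓ m n} → I ≗ J → IsOrderIdeal I → IsOrderIdeal J
  isOrderIdeal-cong I≗J I-ideal x y y≤x x∈J = trans (sym (I≗J y)) (I-ideal x y y≤x (trans (I≗J x) x∈J))

  rowIter-isOrderIdeal : ∀ k {I : Subset ℓ m n} → IsOrderIdeal I → IsOrderIdeal (rowIter k I)
  rowIter-isOrderIdeal zero    I-ideal = I-ideal
  rowIter-isOrderIdeal (suc k) {I} _   = row-isOrderIdeal (rowIter k I)

  rowIter-cong : ∀ k {I J : Subset ℓ m n} → I ≗ J → rowIter k I ≗ rowIter k J
  rowIter-cong zero    I≗J = I≗J
  rowIter-cong (suc k) I≗J = row-cong (rowIter-cong k I≗J)

  rowIter-+ : ∀ i j (I : Subset ℓ m n) → rowIter (i + j) I ≡ rowIter i (rowIter j I)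
  rowIter-+ zero    j I = refl
  rowIter-+ (suc i) j I = cong row (rowIter-+ i j I)

  rowIter-injective : ∀ k {I J : Subset ℓ m n} → IsOrderIdeal I → IsOrderIdeal J →
                      rowIter k I ≗ rowIter k J → I ≗ J
  rowIter-injective zero    _       _       e = e
  rowIter-injective (suc k) I-ideal J-ideal e =
    rowIter-injective k I-ideal J-ideal
      (row-injective (rowIter-isOrderIdeal k I-ideal) (rowIter-isOrderIdeal k J-ideal) e)

  rowIter-*-fixed : ∀ q {d} {I : Subset ℓ m n} → rowIter d I ≗ I → rowIter (q * d) I ≗ I
  rowIter-*-fixed zero    _     _ = refl
  rowIter-*-fixed (suc q) {d} {I} fixed x = begin
    rowIter (d + q * d) I x          ≡⟨ cong (λ J → J x) (rowIter-+ d (q * d) I) ⟩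
    rowIter d (rowIter (q * d) I) x  ≡⟨ rowIter-cong d (rowIter-*-fixed q fixed) x ⟩
    rowIter d I x                    ≡⟨ fixed x ⟩
    I x                              ∎
    where open ≡-Reasoning

  rowIter-∣-fixed : ∀ {d k} {I : Subset ℓ m n} → d ∣ k → rowIter d I ≗ I → rowIter k I ≗ I
  rowIter-∣-fixed (divides q refl) = rowIter-*-fixed q

  minimal-period-∣ : ∀ d .{{_ : NonZero d}} {k} {I : Subset ℓ m n} → rowIter d I ≗ I →
                     (∀ r → 0 < r → r < d → ¬ rowIter r I ≗ I) → rowIter k I ≗ I → d ∣ k
  minimal-period-∣ d {k} {I} d-fixed d-minimal k-fixed =
    m%n≡0⇒n∣m k d (n≤0⇒n≡0 (≮⇒≥ λ 0<r → d-minimal (k % d) 0<r (m%n<n k d) remainder-fixed))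
    where
    open ≡-Reasoning
    remainder-fixed : rowIter (k % d) I ≗ I
    remainder-fixed x = begin
      rowIter (k % d) I x                           ≡⟨ rowIter-cong (k % d) (rowIter-*-fixed (k / d) d-fixed) x ⟨
      rowIter (k % d) (rowIter (k / d * d) I) x     ≡⟨ cong (λ J → J x) (rowIter-+ (k % d) (k / d * d) I) ⟨
      rowIter (k % d + k / d * d) I x               ≡⟨ cong (λ j → rowIter j I x) (m≡m%n+[m/n]*n k d) ⟨
      rowIter k I x                                 ≡⟨ k-fixed x ⟩
      I x                                           ∎

  N : ℕ
  N = ℓ * (m * n)

  Fin↔E : Fin N ↔ E
  Fin↔E = ↔-trans *↔× (↔-refl ×-↔ *↔×)

  open SubsetCode Fin↔E

  rowIter-returns : ∀ {I : Subset ℓ m n} → IsOrderIdeal I → ∃[ d ] 0 < d × d ≤ 2 ^ N × rowIter d I ≗ I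
  rowIter-returns {I} I-ideal
    with i , j , i<j , same-code ← pigeonhole ≤-refl (λ i → encode (rowIter (toℕ i) I)) =
    d , m<n⇒0<n∸m i<j , ≤-trans (m∸n≤m (toℕ j) (toℕ i)) (toℕ≤pred[n] j) ,
    λ x → sym (rowIter-injective (toℕ i) I-ideal (rowIter-isOrderIdeal d I-ideal) i≗i+d x)
    where
    d = toℕ j ∸ toℕ i
    i≗i+d : rowIter (toℕ i) I ≗ rowIter (toℕ i) (rowIter d I)
    i≗i+d x = begin
      rowIter (toℕ i) I x              ≡⟨ encode-injective same-code x ⟩
      rowIter (toℕ j) I x              ≡⟨ cong (λ t → rowIter t I x) (m+[n∸m]≡n (<⇒≤ i<j)) ⟨
      rowIter (toℕ i + d) I x          ≡⟨ cong (λ J → J x) (rowIter-+ (toℕ i) d I) ⟩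
      rowIter (toℕ i) (rowIter d I) x  ∎
      where open ≡-Reasoning

  rowIter-!-fixes : FixesAllIdeals ℓ m n ((2 ^ N) !)
  rowIter-!-fixes I I-ideal =
    let d , 0<d , d≤2^N , d-fixed = rowIter-returns I-ideal in rowIter-∣-fixed (0<m≤n⇒m∣n! 0<d d≤2^N) d-fixed

  ∀? : ∀ {P : E → Set} → (∀ x → Dec (P x)) → Dec (∀ x → P x)
  ∀? P? = map′ (λ h (a , b , c) → h a b c) (λ h a b c → h (a , b , c))
                (all? λ a → all? λ b → all? λ c → P? (a , b , c))

  isOrderIdeal? : ∀ I → Dec (IsOrderIdeal I)
  isOrderIdeal? I = ∀? λ x → ∀? λ y → y ≤P? x →-dec I x ≟ᵇ true →-dec I y ≟ᵇ true

  ≗? : ∀ (I J : Subset ℓ m n) → Dec (I ≗ J)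
  ≗? I J = ∀? λ x → I x ≟ᵇ J x

  fixesAllIdeals? : Decidable (FixesAllIdeals ℓ m n)
  fixesAllIdeals? k = map′ fromCodes (λ fixes c → fixes (decode c))
    (all? λ c → isOrderIdeal? (decode c) →-dec ≗? (rowIter k (decode c)) (decode c))
    where
    fromCodes : (∀ c → IsOrderIdeal (decode c) → rowIter k (decode c) ≗ decode c) → FixesAllIdeals ℓ m n k
    fromCodes fixes I I-ideal x = begin
      rowIter k I x                    ≡⟨ rowIter-cong k (decode-encode I) x ⟨
      rowIter k (decode (encode I)) x  ≡⟨ fixes (encode I) (isOrderIdeal-cong (sym ∘ decode-encode I) I-ideal) x ⟩
      decode (encode I) x              ≡⟨ decode-encode I x ⟩
      I x                              ∎
      where open ≡-Reasoning

  orderOfRow : ∃ (IsOrderOfRow ℓ m n)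
  orderOfRow = leastPositive fixesAllIdeals? ((2 ^ N) !) (>-nonZero⁻¹ _ {{(2 ^ N) !≢0}}) rowIter-!-fixes

module RankIdeals (a b c : ℕ) where

  open Rowmotion (suc a) (suc b) (suc c)

  maxRank : ℕ
  maxRank = a + b + c

  bottom : E
  bottom = Fin.zero , Fin.zero , Fin.zero

  top : E
  top = Fin.fromℕ a , Fin.fromℕ b , Fin.fromℕ c

  bottom-≤P : ∀ x → bottom ≤P x
  bottom-≤P x = z≤n , z≤n , z≤n

  ≤P-top : ∀ x → x ≤P top
  ≤P-top (x₁ , x₂ , x₃) = below-fromℕ x₁ , below-fromℕ x₂ , below-fromℕ x₃
    where
    below-fromℕ : ∀ {k} (i : Fin (suc k)) → i Fin.≤ Fin.fromℕ k
    below-fromℕ {k} i = ≤-trans (toℕ≤pred[n] i) (≤-reflexive (sym (toℕ-fromℕ k)))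

  rank-top : rank top ≡ maxRank
  rank-top = cong₂ _+_ (cong₂ _+_ (toℕ-fromℕ a) (toℕ-fromℕ b)) (toℕ-fromℕ c)

  rank≤maxRank : ∀ x → rank x ≤ maxRank
  rank≤maxRank x = ≤-trans (rank-mono (≤P-top x)) (≤-reflexive rank-top)

  rankIdeal : ℕ → Subset (suc a) (suc b) (suc c)
  rankIdeal r x = does (rank x <? r)

  rankIdeal-isOrderIdeal : ∀ r → IsOrderIdeal (rankIdeal r)
  rankIdeal-isOrderIdeal r x y y≤x x∈L =
    dec-true (rank y <? r) (≤-<-trans (rank-mono y≤x) (does-true⁻ (rank x <? r) x∈L))

  minimal-outside-rankIdeal⇒rank≤ : ∀ {r y} → minimalOfComplement (rankIdeal r) y ≡ true → rank y ≤ r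
  minimal-outside-rankIdeal⇒rank≤ {r} {y} my = ≮⇒≥ λ r<ry →
    let z , _ , z≤y , rz≡r = between (bottom-≤P y) z≤n (<⇒≤ r<ry)
        z<y = rank<⇒ltb z≤y (subst (_< rank y) (sym rz≡r) r<ry)
    in <-irrefl rz≡r (does-true⁻ (rank z <? r) (proj₂ (minimal⁻ (rankIdeal r) my) z z<y))

  row-rankIdeal : ∀ {r} → r ≤ maxRank → row (rankIdeal r) ≗ rankIdeal (suc r)
  row-rankIdeal {r} r≤max x = Bool-ext grown kept
    where
    grown : row (rankIdeal r) x ≡ true → rankIdeal (suc r) x ≡ true
    grown h =
      let y , my , x≤y = row⁻ (rankIdeal r) {x} h in
      dec-true (rank x <? suc r) (s≤s (≤-trans (rank-mono {x} {y} x≤y) (minimal-outside-rankIdeal⇒rank≤ my)))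
    kept : rankIdeal (suc r) x ≡ true → row (rankIdeal r) x ≡ true
    kept h =
      let rx≤r = s≤s⁻¹ (does-true⁻ (rank x <? suc r) h)
          z , x≤z , _ , rz≡r = between {x} {top} (≤P-top x) rx≤r (subst (r ≤_) (sym rank-top) r≤max)
      in row⁺ (rankIdeal r) {x} {z}
           (minimal⁺ (rankIdeal r) (dec-false (rank z <? r) (<-irrefl rz≡r))
             (λ w w<z → dec-true (rank w <? r) (subst (rank w <_) rz≡r (ltb⇒rank< {w} {z} w<z))))
           x≤z

  row-rankIdeal-full : row (rankIdeal (suc maxRank)) ≗ rankIdeal 0
  row-rankIdeal-full x =
    Bool-ext (⊥-elim ∘ nothing-outside) (λ x∈L₀ → contradiction (does-true⁻ (rank x <? 0) x∈L₀) n≮0)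
    where
    nothing-outside : ¬ row (rankIdeal (suc maxRank)) x ≡ true
    nothing-outside h =
      let y , my , _ = row⁻ (rankIdeal (suc maxRank)) {x} h
      in true≢false (dec-true (rank y <? suc maxRank) (s≤s (rank≤maxRank y)))
                    (proj₁ (minimal⁻ (rankIdeal (suc maxRank)) {y} my))

  rowIter-rankIdeal : ∀ r → r ≤ suc maxRank → rowIter r (rankIdeal 0) ≗ rankIdeal r
  rowIter-rankIdeal zero    _    = λ _ → refl
  rowIter-rankIdeal (suc r) r<sm x =
    trans (row-cong (rowIter-rankIdeal r (<⇒≤ r<sm)) x) (row-rankIdeal (s≤s⁻¹ r<sm) x)

  rankOrbit-period : rowIter (suc (suc maxRank)) (rankIdeal 0) ≗ rankIdeal 0
  rankOrbit-period x = trans (row-cong (rowIter-rankIdeal (suc maxRank) ≤-refl) x) (row-rankIdeal-full x)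

  rankOrbit-no-earlier-return : ∀ r → 0 < r → r < suc (suc maxRank) →
                                ¬ rowIter r (rankIdeal 0) ≗ rankIdeal 0
  rankOrbit-no-earlier-return r 0<r r<period returns = true≢false bottom∈L₀ (dec-false (0 <? 0) n≮0)
    where
    bottom∈L₀ : rankIdeal 0 bottom ≡ true
    bottom∈L₀ = begin
      rankIdeal 0 bottom                  ≡⟨ returns bottom ⟨
      rowIter r (rankIdeal 0) bottom      ≡⟨ rowIter-rankIdeal r (s≤s⁻¹ r<period) bottom ⟩
      rankIdeal r bottom                  ≡⟨ dec-true (0 <? r) 0<r ⟩
      true                                ∎
      where open ≡-Reasoning

  rankOrbit-period-∣ : ∀ {k} → rowIter k (rankIdeal 0) ≗ rankIdeal 0 → suc (suc maxRank) ∣ k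
  rankOrbit-period-∣ = minimal-period-∣ (suc (suc maxRank)) rankOrbit-period rankOrbit-no-earlier-return

theorem7p4 : (ℓ m n : ℕ) → 1 ≤ ℓ → 1 ≤ m → 1 ≤ n →
    Σ ℕ (λ k → IsOrderOfRow ℓ m n k × ((m + n + ℓ ∸ 1) ∣ k))
theorem7p4 (suc a) (suc b) (suc c) _ _ _ =
  let k , k-order = orderOfRow
      _ , k-fixes , _ = k-order
  in k , k-order ,
     subst (_∣ k) (orbit-length a b c) (rankOrbit-period-∣ (k-fixes (rankIdeal 0) (rankIdeal-isOrderIdeal 0)))
  where
  open Rowmotion (suc a) (suc b) (suc c) using (orderOfRow)
  open RankIdeals a b c
  orbit-length : ∀ a b c → suc (suc (a + b + c)) ≡ suc b + suc c + suc a ∸ 1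
  orbit-length = solve 3 (λ a b c → con 2 :+ (a :+ b :+ c) := b :+ (con 1 :+ c) :+ (con 1 :+ a)) refl
    where open ℕ-Solver.+-*-Solver
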